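{- Let $Q$ be a prime and let $\mathbf{v}_1,\dots,\mathbf{v}_N,\mathbf{y}_1,\dots,\mathbf{y}_N\in\mathbb{Z}_Q^n$ with $\mathbf{v}_i\ne\mathbf{0}\bmod Q$ for all $i$ and $\mathbf{y}_i\ne\mathbf{y}_1$ for all $i>1$. Let $\mathbf{z},\mathbf{c}\in\mathbb{Z}_Q^n$ be sampled uniformly and independently at random, with all inner products taken modulo $Q$. Then \[\frac1Q-\frac{2N}{Q^2}-\frac{N}{Q^n}\le\Pr\big[\langle\mathbf{z},\mathbf{y}_1+\mathbf{c}\rangle=0,\ \langle\mathbf{z},\mathbf{v}_i\rangle\ne0\ \forall i,\ \text{and}\ \langle\mathbf{z},\mathbf{y}_i+\mathbf{c}\rangle\ne0\ \forall i>1\big]\le\frac1Q+\frac1{Q^n}.\] -}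

module Defs where

open import Data.Nat using (ℕ; zero; suc; _+_; _*_; _^_; _≡ᵇ_)
open import Data.Nat.DivMod using (_%_; m%n<n)
open import Data.Fin using (Fin; toℕ; fromℕ<)
open import Data.Vec using (Vec; []; _∷_; zipWith; foldr)
open import Data.List using (List; []; _∷_; map; concatMap; allFin; length; cartesianProduct)
open import Data.Bool.ListAction using (all)
import Data.List as L
open import Data.Bool using (Bool; true; false; not; _∧_)
open import Data.Product using (_×_; _,_)
open import Data.Integer using (+_)
open import Data.Rational using (ℚ; 0ℚ; _/_)

-- Elements of ℤ_Q are represented by Fin Q (residues 0..Q-1).
-- Reduction of a natural number modulo Q (identity when Q = 0; irrelevant since Q is prime).
_mod'_ : ℕ → ℕ → ℕ
m mod' zero = m
m mod' suc q = m % suc q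

addZ : ∀ {Q} → Fin Q → Fin Q → Fin Q
addZ {suc q} a b = fromℕ< (m%n<n (toℕ a + toℕ b) (suc q))

_⊕_ : ∀ {Q n} → Vec (Fin Q) n → Vec (Fin Q) n → Vec (Fin Q) n
_⊕_ = zipWith addZ

⟨_,_⟩ : ∀ {Q n} → Vec (Fin Q) n → Vec (Fin Q) n → ℕ
⟨_,_⟩ {Q} u w = foldr _ _+_ 0 (zipWith (λ a b → toℕ a * toℕ b) u w) mod' Q

allVecs : ∀ Q n → List (Vec (Fin Q) n)
allVecs Q zero = [] ∷ []
allVecs Q (suc n) = concatMap (λ a → map (a ∷_) (allVecs Q n)) (allFin Q)

-- The event of the lemma, for N = suc M vectors indexed by Fin (suc M),
-- index Fin.zero playing the role of index 1.
event : ∀ {Q n M} → (v y : Fin (suc M) → Vec (Fin Q) n)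
      → Vec (Fin Q) n × Vec (Fin Q) n → Bool
event {M = M} v y (z , c) =
  (⟨ z , y Fin.zero ⊕ c ⟩ ≡ᵇ 0)
  ∧ all (λ i → not (⟨ z , v i ⟩ ≡ᵇ 0)) (allFin (suc M))
  ∧ all (λ i → not (⟨ z , y (Fin.suc i) ⊕ c ⟩ ≡ᵇ 0)) (allFin M)
  where import Data.Fin as Fin

-- m ÷ d as a rational number (0 when d = 0; never used with d = 0 here).
infixl 7 _÷_
_÷_ : ℕ → ℕ → ℚ
m ÷ zero = 0ℚ
m ÷ suc d = (+ m) / suc d

-- Pr over (z, c) uniform and independent in ℤ_Q^n × ℤ_Q^n:
-- (number of pairs satisfying the event) / Q^(2n).
prob : ∀ {Q n M} → (v y : Fin (suc M) → Vec (Fin Q) n) → ℚ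
prob {Q} {n} v y =
  length (L.filter (λ p → event v y p Data.Bool.≟ true) (cartesianProduct (allVecs Q n) (allVecs Q n)))
    ÷ (Q ^ (n + n))

{-# OPTIONS --safe #-}
-- For fixed z, the event forces ⟨z, y₁ + c⟩ ≡ 0, a hyperplane condition on c with exactly
-- Q^(n-1) solutions when z ≢ 0, and it is impossible when ⟨z, v₁⟩ ≡ 0 (in particular when
-- z = 0); summing over z gives Pr ≤ 1/Q. Conversely, if ⟨z, vᵢ⟩ ≢ 0 and ⟨z, yᵢ⟩ ≢ ⟨z, y₁⟩
-- for all i, then every c on that hyperplane belongs to the event, because there
-- ⟨z, yᵢ + c⟩ ≡ ⟨z, yᵢ⟩ - ⟨z, y₁⟩. Each of these 2N - 1 conditions on z fails on a hyperplane
-- of Q^(n-1) points only, so a union bound gives Pr ≥ 1/Q - (2N - 1)/Q². Both counts rest on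
-- one fact: for u ≢ w the congruence r + ⟨x, u⟩ ≡ s + ⟨x, w⟩ has exactly Q^(n-1) solutions,
-- since along a coordinate where u and w differ it becomes a linear congruence in one
-- unknown with nonzero coefficient, which has exactly one solution as Q is prime.
module Submission where

open import Defs

-- Kept apart so that its ℕ operators do not clash with the ℚ operators in the type of lemmaA1.
module EventCounting where

  open import Level using (Level; 0ℓ)
  open import Function using (_∘_; _⇔_; mk⇔; Equivalence)
  open import Function.Properties.Equivalence using (⇔-setoid)
    renaming (refl to ⇔-refl; sym to ⇔-sym; trans to ⇔-trans)
  open import Data.Bool using (Bool; true; false; not; T; T?)
  import Data.Bool as Bool
  open import Data.Bool.Properties using (T-∧)
  open import Data.Bool.ListAction using (all)
  open import Data.Product using (_×_; _,_; ∃; proj₁; proj₂)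
  open import Data.Product.Function.NonDependent.Propositional using (_×-⇔_)
  open import Data.Sum using (_⊎_; inj₁; inj₂; [_,_])
  open import Data.Empty using (⊥-elim)
  open import Data.Nat using (ℕ; zero; suc; _+_; _*_; _^_; _≤_; _<_; z≤n; _≡ᵇ_; NonZero; ≢-nonZero)
  open import Data.Nat.Properties
  open import Algebra.Properties.CommutativeSemigroup +-commutativeSemigroup
    using () renaming (interchange to +-interchange)
  open import Data.Fin using (Fin; toℕ; fromℕ<)
  import Data.Fin.Properties as Finₚ
  open import Data.Fin.Properties using (toℕ-fromℕ<; toℕ-injective; toℕ<n)
  import Data.Fin as F
  open import Data.Vec using (Vec; []; _∷_)
  import Data.Vec as Vec
  import Data.Vec.Properties as Vecₚ
  open import Data.List using (List; []; _∷_; _++_; map; concatMap; allFin; length; cartesianProduct)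
  import Data.List as L
  open import Data.List.Properties using (map-tabulate; length-tabulate)
  import Data.List.Relation.Unary.All.Properties as Allₚ
  open import Data.Nat.DivMod
    using (_%_; m%n%n≡m%n; [m+kn]%n≡m%n; %-distribˡ-+; %-distribˡ-*; m<n⇒m%n≡m; m%n<n)
  open import Data.Nat.Divisibility using (_∣_; m%n≡0⇒n∣m; n∣m⇒m%n≡0)
  open import Data.Nat.Primality using (Prime; euclidsLemma)
  open import Data.Nat.Coprimality using (prime⇒coprime; coprime-Bézout)
  open import Data.Nat.GCD using (module Bézout)
  open import Data.Nat.Tactic.RingSolver using (solve-∀)
  open import Relation.Binary using (Setoid; IsEquivalence)
  import Relation.Binary.Reasoning.Setoid as SetoidReasoning
  open import Relation.Binary.PropositionalEquality
    using (_≡_; _≢_; refl; sym; trans; cong; cong₂; subst₂; module ≡-Reasoning)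
  open import Relation.Nullary using (¬_; yes; no)
  import Data.Integer as ℤ
  import Data.Integer.Properties as ℤₚ
  open import Data.Rational using (0ℚ; toℚᵘ) renaming (_≤_ to _≤ℚ_; _+_ to _+ℚ_; _-_ to _-ℚ_; -_ to -ℚ_)
  import Data.Rational.Properties as ℚₚ
  open import Data.Rational.Unnormalised using (mkℚᵘ; *≤*) renaming (_≃_ to _≃ᵘ_; _+_ to _+ᵘ_)
  import Data.Rational.Unnormalised.Properties as ℚᵘₚ

  private
    variable
      a b : Level
      A : Set a
      B : Set b

  module ⇔-Reasoning = SetoidReasoning (⇔-setoid 0ℓ)

  ≡⇒⇔ : {A B : Set a} → A ≡ B → A ⇔ B
  ≡⇒⇔ refl = ⇔-refl

  infix 5 ∑
  ∑ : List A → (A → ℕ) → ℕ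
  ∑ []       f = 0
  ∑ (x ∷ xs) f = f x + ∑ xs f

  syntax ∑ xs (λ x → e) = ∑[ x ∈ xs ] e

  χ : Bool → ℕ
  χ true  = 1
  χ false = 0

  count : (A → Bool) → List A → ℕ
  count P xs = ∑[ x ∈ xs ] χ (P x)

  ∑-cong : ∀ xs {f g : A → ℕ} → (∀ x → f x ≡ g x) → ∑ xs f ≡ ∑ xs g
  ∑-cong []       f≗g = refl
  ∑-cong (x ∷ xs) f≗g = cong₂ _+_ (f≗g x) (∑-cong xs f≗g)

  ∑-mono-≤ : ∀ xs {f g : A → ℕ} → (∀ x → f x ≤ g x) → ∑ xs f ≤ ∑ xs g
  ∑-mono-≤ []       f≤g = z≤n
  ∑-mono-≤ (x ∷ xs) f≤g = +-mono-≤ (f≤g x) (∑-mono-≤ xs f≤g)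

  ∑-distrib-+ : ∀ xs (f g : A → ℕ) → ∑[ x ∈ xs ] (f x + g x) ≡ ∑ xs f + ∑ xs g
  ∑-distrib-+ []       f g = refl
  ∑-distrib-+ (x ∷ xs) f g =
    trans (cong (f x + g x +_) (∑-distrib-+ xs f g)) (+-interchange (f x) (g x) (∑ xs f) (∑ xs g))

  ∑-distribˡ-* : ∀ xs (f : A → ℕ) k → ∑[ x ∈ xs ] k * f x ≡ k * ∑ xs f
  ∑-distribˡ-* []       f k = sym (*-zeroʳ k)
  ∑-distribˡ-* (x ∷ xs) f k =
    trans (cong (k * f x +_) (∑-distribˡ-* xs f k)) (sym (*-distribˡ-+ k (f x) (∑ xs f)))

  ∑-distribʳ-* : ∀ xs (f : A → ℕ) k → ∑[ x ∈ xs ] f x * k ≡ ∑ xs f * k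
  ∑-distribʳ-* []       f k = refl
  ∑-distribʳ-* (x ∷ xs) f k =
    trans (cong (f x * k +_) (∑-distribʳ-* xs f k)) (sym (*-distribʳ-+ k (f x) (∑ xs f)))

  ∑-const : ∀ (xs : List A) k → ∑[ x ∈ xs ] k ≡ length xs * k
  ∑-const []       k = refl
  ∑-const (x ∷ xs) k = cong (k +_) (∑-const xs k)

  ∑-++ : ∀ (xs ys : List A) f → ∑ (xs ++ ys) f ≡ ∑ xs f + ∑ ys f
  ∑-++ []       ys f = refl
  ∑-++ (x ∷ xs) ys f = trans (cong (f x +_) (∑-++ xs ys f)) (sym (+-assoc (f x) _ _))

  ∑-map : ∀ (g : A → B) xs f → ∑ (map g xs) f ≡ ∑ xs (f ∘ g)
  ∑-map g []       f = refl
  ∑-map g (x ∷ xs) f = cong (f (g x) +_) (∑-map g xs f)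

  ∑-concatMap : ∀ (g : A → List B) xs f → ∑ (concatMap g xs) f ≡ ∑[ x ∈ xs ] ∑ (g x) f
  ∑-concatMap g []       f = refl
  ∑-concatMap g (x ∷ xs) f = trans (∑-++ (g x) _ f) (cong (∑ (g x) f +_) (∑-concatMap g xs f))

  ∑-cartesianProduct : ∀ (xs : List A) (ys : List B) f →
                       ∑ (cartesianProduct xs ys) f ≡ ∑[ x ∈ xs ] ∑[ y ∈ ys ] f (x , y)
  ∑-cartesianProduct []       ys f = refl
  ∑-cartesianProduct (x ∷ xs) ys f =
    trans (∑-++ (map (x ,_) ys) _ f) (cong₂ _+_ (∑-map (x ,_) ys f) (∑-cartesianProduct xs ys f))

  ∑-comm : ∀ (xs : List A) (ys : List B) (f : A → B → ℕ) →
           ∑[ x ∈ xs ] ∑[ y ∈ ys ] f x y ≡ ∑[ y ∈ ys ] ∑[ x ∈ xs ] f x y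
  ∑-comm []       ys f = sym (trans (∑-const ys 0) (*-zeroʳ (length ys)))
  ∑-comm (x ∷ xs) ys f = trans (cong (∑ ys (f x) +_) (∑-comm xs ys f)) (sym (∑-distrib-+ ys (f x) _))

  ∑-allFin-suc : ∀ m (f : Fin (suc m) → ℕ) →
                 ∑ (allFin (suc m)) f ≡ f F.zero + (∑[ i ∈ allFin m ] f (F.suc i))
  ∑-allFin-suc m f = cong (f F.zero +_)
    (trans (cong (λ xs → ∑ xs f) (sym (map-tabulate (λ i → i) F.suc))) (∑-map F.suc (allFin m) f))

  length-filter≡count : ∀ (P : A → Bool) xs → length (L.filter (λ x → P x Bool.≟ true) xs) ≡ count P xs
  length-filter≡count P []       = refl
  length-filter≡count P (x ∷ xs) with P x
  ... | true  = cong suc (length-filter≡count P xs)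
  ... | false = length-filter≡count P xs

  χ-mono : ∀ {b c} → (T b → T c) → χ b ≤ χ c
  χ-mono {false} b⇒c = z≤n
  χ-mono {true}  {true} b⇒c = ≤-refl
  χ-mono {true}  {false} b⇒c = ⊥-elim (b⇒c _)

  χ-cong : ∀ {b c} → T b ⇔ T c → χ b ≡ χ c
  χ-cong b⇔c = ≤-antisym (χ-mono (Equivalence.to b⇔c)) (χ-mono (Equivalence.from b⇔c))

  count-mono : ∀ {P R : A → Bool} xs → (∀ x → T (P x) → T (R x)) → count P xs ≤ count R xs
  count-mono xs P⇒R = ∑-mono-≤ xs (λ x → χ-mono (P⇒R x))

  count-none : ∀ {P : A → Bool} xs → (∀ x → ¬ T (P x)) → count P xs ≡ 0
  count-none []       ¬P = refl
  count-none (x ∷ xs) ¬P = cong₂ _+_ (χ-cong (mk⇔ (λ p → ⊥-elim (¬P x p)) (λ ()))) (count-none xs ¬P)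

  count-unique : ∀ m {P : Fin m → Bool} t₀ → T (P t₀) → (∀ t → T (P t) → t ≡ t₀) → count P (allFin m) ≡ 1
  count-unique (suc m) {P} F.zero P0 unique = trans (∑-allFin-suc m (χ ∘ P)) (cong₂ _+_
    (χ-cong (mk⇔ (λ _ → _) (λ _ → P0)))
    (count-none (allFin m) (λ t Pt → Finₚ.0≢1+n (sym (unique (F.suc t) Pt)))))
  count-unique (suc m) {P} (F.suc t₀) Pt₀ unique = trans (∑-allFin-suc m (χ ∘ P)) (cong₂ _+_
    (χ-cong (mk⇔ (λ P0 → Finₚ.0≢1+n (unique F.zero P0)) (λ ())))
    (count-unique m t₀ Pt₀ (λ t Pt → Finₚ.suc-injective (unique (F.suc t) Pt))))

  T-not⇔¬T : ∀ {b} → T (not b) ⇔ (¬ T b)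
  T-not⇔¬T {true}  = mk⇔ (λ ()) (λ ¬t → ¬t _)
  T-not⇔¬T {false} = mk⇔ (λ _ ()) (λ _ → _)

  T-all-not-allFin : ∀ m (P : Fin m → Bool) → T (all (λ i → not (P i)) (allFin m)) ⇔ (∀ i → ¬ T (P i))
  T-all-not-allFin m P = mk⇔
    (λ t i → Equivalence.to T-not⇔¬T (Allₚ.tabulate⁻ (Allₚ.all⁺ _ (allFin m) t) i))
    (λ ¬P → Allₚ.all⁻ _ (Allₚ.tabulate⁺ (λ i → Equivalence.from T-not⇔¬T (¬P i))))

  χ≡0⇒¬T : ∀ {b} → χ b ≡ 0 → ¬ T b
  χ≡0⇒¬T {false} _ ()

  count≡0⇒¬T : ∀ m {P : Fin m → Bool} → count P (allFin m) ≡ 0 → ∀ i → ¬ T (P i)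
  count≡0⇒¬T (suc m) {P} #P≡0 = at
    where
    split : χ (P F.zero) + count (P ∘ F.suc) (allFin m) ≡ 0
    split = trans (sym (∑-allFin-suc m (χ ∘ P))) #P≡0
    at : ∀ i → ¬ T (P i)
    at F.zero    = χ≡0⇒¬T (m+n≡0⇒m≡0 _ split)
    at (F.suc i) = count≡0⇒¬T m (m+n≡0⇒n≡0 _ split) i

  ∑-allVecs-suc : ∀ Q n (f : Vec (Fin Q) (suc n) → ℕ) →
                  ∑ (allVecs Q (suc n)) f ≡ ∑[ t ∈ allFin Q ] ∑[ x ∈ allVecs Q n ] f (t ∷ x)
  ∑-allVecs-suc Q n f =
    trans (∑-concatMap _ (allFin Q) f) (∑-cong (allFin Q) (λ t → ∑-map (t ∷_) (allVecs Q n) f))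

  ∑-allFin-const : ∀ m k → ∑[ i ∈ allFin m ] k ≡ m * k
  ∑-allFin-const m k = trans (∑-const (allFin m) k) (cong (_* k) (length-tabulate {n = m} (λ i → i)))

  ∑-count-allFin : ∀ (xs : List A) {m} (P : A → Fin m → Bool) {c} →
                   (∀ i → count (λ x → P x i) xs ≡ c) → ∑[ x ∈ xs ] count (P x) (allFin m) ≡ m * c
  ∑-count-allFin xs {m} P {c} count≡c =
    trans (∑-comm xs (allFin m) _) (trans (∑-cong (allFin m) count≡c) (∑-allFin-const m c))

  ∑-allVecs-const : ∀ Q n k → ∑[ x ∈ allVecs Q n ] k ≡ Q ^ n * k
  ∑-allVecs-const Q zero    k = refl
  ∑-allVecs-const Q (suc n) k = begin
    ∑ (allVecs Q (suc n)) (λ _ → k)          ≡⟨ ∑-allVecs-suc Q n (λ _ → k) ⟩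
    ∑[ t ∈ allFin Q ] ∑[ x ∈ allVecs Q n ] k ≡⟨ ∑-cong (allFin Q) (λ _ → ∑-allVecs-const Q n k) ⟩
    ∑[ t ∈ allFin Q ] Q ^ n * k               ≡⟨ ∑-allFin-const Q (Q ^ n * k) ⟩
    Q * (Q ^ n * k)                           ≡⟨ *-assoc Q (Q ^ n) k ⟨
    Q ^ suc n * k                             ∎
    where open ≡-Reasoning

  module Congruence (q : ℕ) where

    Q : ℕ
    Q = suc q

    infix 4 _≈_ _≉_
    record _≈_ (m n : ℕ) : Set where
      constructor mod-≡
      field %-≡ : m % Q ≡ n % Q
    open _≈_ public

    _≉_ : ℕ → ℕ → Set
    m ≉ n = ¬ (m ≈ n)

    ≈-isEquivalence : IsEquivalence _≈_
    ≈-isEquivalence = record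
      { refl  = mod-≡ refl
      ; sym   = λ m≈n → mod-≡ (sym (%-≡ m≈n))
      ; trans = λ m≈n n≈o → mod-≡ (trans (%-≡ m≈n) (%-≡ n≈o))
      }

    ≈-setoid : Setoid 0ℓ 0ℓ
    ≈-setoid = record { isEquivalence = ≈-isEquivalence }

    open IsEquivalence ≈-isEquivalence public
      using () renaming (refl to ≈-refl; sym to ≈-sym; trans to ≈-trans)
    module ≈-Reasoning = SetoidReasoning ≈-setoid

    ≡⇒≈ : ∀ {m n} → m ≡ n → m ≈ n
    ≡⇒≈ refl = ≈-refl

    m%Q≈m : ∀ m → m % Q ≈ m
    m%Q≈m m = mod-≡ (m%n%n≡m%n m Q)

    m+kQ≈m : ∀ m k → m + k * Q ≈ m
    m+kQ≈m m k = mod-≡ ([m+kn]%n≡m%n m k Q)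

    +-cong : ∀ {m n o p} → m ≈ n → o ≈ p → m + o ≈ n + p
    +-cong {m} {n} {o} {p} (mod-≡ m≈n) (mod-≡ o≈p) = mod-≡ (begin
      (m + o) % Q             ≡⟨ %-distribˡ-+ m o Q ⟩
      (m % Q + o % Q) % Q     ≡⟨ cong₂ (λ x y → (x + y) % Q) m≈n o≈p ⟩
      (n % Q + p % Q) % Q     ≡⟨ %-distribˡ-+ n p Q ⟨
      (n + p) % Q             ∎)
      where open ≡-Reasoning

    *-cong : ∀ {m n o p} → m ≈ n → o ≈ p → m * o ≈ n * p
    *-cong {m} {n} {o} {p} (mod-≡ m≈n) (mod-≡ o≈p) = mod-≡ (begin
      (m * o) % Q             ≡⟨ %-distribˡ-* m o Q ⟩
      (m % Q * (o % Q)) % Q   ≡⟨ cong₂ (λ x y → (x * y) % Q) m≈n o≈p ⟩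
      (n % Q * (p % Q)) % Q   ≡⟨ %-distribˡ-* n p Q ⟨
      (n * p) % Q             ∎)
      where open ≡-Reasoning

    +-congˡ : ∀ m {o p} → o ≈ p → m + o ≈ m + p
    +-congˡ m = +-cong (≈-refl {m})

    +-congʳ : ∀ {m n} o → m ≈ n → m + o ≈ n + o
    +-congʳ o m≈n = +-cong m≈n (≈-refl {o})

    *-congˡ : ∀ m {o p} → o ≈ p → m * o ≈ m * p
    *-congˡ m = *-cong (≈-refl {m})

    *-congʳ : ∀ {m n} o → m ≈ n → m * o ≈ n * o
    *-congʳ o m≈n = *-cong m≈n (≈-refl {o})

    +-cancelʳ : ∀ {m n} o → m + o ≈ n + o → m ≈ n
    +-cancelʳ {m} {n} o m+o≈n+o = begin
      m                ≈⟨ m+kQ≈m m o ⟨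
      m + o * Q        ≡⟨ add-multiple m ⟩
      m + o + o * q    ≈⟨ +-congʳ (o * q) m+o≈n+o ⟩
      n + o + o * q    ≡⟨ add-multiple n ⟨
      n + o * Q        ≈⟨ m+kQ≈m n o ⟩
      n                ∎
      where
      open ≈-Reasoning
      add-multiple : ∀ x → x + o * Q ≡ x + o + o * q
      add-multiple x = trans (cong (x +_) (*-suc o q)) (sym (+-assoc x o (o * q)))

    +-cancelˡ : ∀ o {m n} → o + m ≈ o + n → m ≈ n
    +-cancelˡ o {m} {n} o+m≈o+n =
      +-cancelʳ o (≈-trans (≡⇒≈ (+-comm m o)) (≈-trans o+m≈o+n (≡⇒≈ (+-comm o n))))

    -- q ≡ -1 (mod Q), so q * n represents -n.
    ≈⇔+q*≈0 : ∀ {m n} → m ≈ n ⇔ m + q * n ≈ 0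
    ≈⇔+q*≈0 {n = n} = mk⇔
      (λ m≈n → ≈-trans (+-congʳ (q * n) m≈n) (≈-trans (≡⇒≈ (n+qn≡nQ n)) (m+kQ≈m 0 n)))
      (λ m+qn≈0 → +-cancelʳ (q * n)
        (≈-trans m+qn≈0 (≈-trans (≈-sym (m+kQ≈m 0 n)) (≡⇒≈ (sym (n+qn≡nQ n))))))
      where
      n+qn≡nQ : ∀ n → n + q * n ≡ 0 + n * Q
      n+qn≡nQ n = trans (cong (n +_) (*-comm q n)) (sym (*-suc n q))

    ≈-respˡ-⇔ : ∀ {m m′ n} → m ≈ m′ → (m ≈ n) ⇔ (m′ ≈ n)
    ≈-respˡ-⇔ m≈m′ = mk⇔ (≈-trans (≈-sym m≈m′)) (≈-trans m≈m′)

    ≈⇒≡ : ∀ {m n} → m < Q → n < Q → m ≈ n → m ≡ n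
    ≈⇒≡ {m} {n} m<Q n<Q (mod-≡ m≈n) = begin
      m      ≡⟨ m<n⇒m%n≡m m<Q ⟨
      m % Q  ≡⟨ m≈n ⟩
      n % Q  ≡⟨ m<n⇒m%n≡m n<Q ⟩
      n      ∎
      where open ≡-Reasoning

    T-≡ᵇ⇔≈ : ∀ {m n} → T (m % Q ≡ᵇ n % Q) ⇔ m ≈ n
    T-≡ᵇ⇔≈ = mk⇔ (λ t → mod-≡ (≡ᵇ⇒≡ _ _ t)) (λ m≈n → ≡⇒≡ᵇ _ _ (%-≡ m≈n))

  module PrimeCongruence (q : ℕ) (prime : Prime (suc q)) where

    open Congruence q

    ≈0⇔∣ : ∀ {m} → m ≈ 0 ⇔ Q ∣ m
    ≈0⇔∣ {m} = mk⇔ (λ m≈0 → m%n≡0⇒n∣m m Q (%-≡ m≈0)) (λ Q∣m → mod-≡ (n∣m⇒m%n≡0 m Q Q∣m))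

    *≈0⇒≈0⊎≈0 : ∀ m n → m * n ≈ 0 → m ≈ 0 ⊎ n ≈ 0
    *≈0⇒≈0⊎≈0 m n mn≈0 with euclidsLemma m n prime (Equivalence.to ≈0⇔∣ mn≈0)
    ... | inj₁ Q∣m = inj₁ (Equivalence.from ≈0⇔∣ Q∣m)
    ... | inj₂ Q∣n = inj₂ (Equivalence.from ≈0⇔∣ Q∣n)

    private
      *-cancelʳ-when-≤ : ∀ {m n o} → o ≉ 0 → m ≤ n → m * o ≈ n * o → m ≈ n
      *-cancelʳ-when-≤ {m} {o = o} o≉0 m≤n mo≈no with d , refl ← m≤n⇒∃[o]m+o≡n m≤n =
        [ (λ d≈0 → ≈-trans (≡⇒≈ (sym (+-identityʳ m))) (+-congˡ m (≈-sym d≈0)))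
        , (λ o≈0 → ⊥-elim (o≉0 o≈0))
        ] (*≈0⇒≈0⊎≈0 d o do≈0)
        where
        do≈0 : d * o ≈ 0
        do≈0 = +-cancelʳ (m * o)
          (≈-trans (≡⇒≈ (trans (+-comm (d * o) (m * o)) (sym (*-distribʳ-+ o m d)))) (≈-sym mo≈no))

    *-cancelʳ : ∀ {m n o} → o ≉ 0 → m * o ≈ n * o → m ≈ n
    *-cancelʳ {m} {n} o≉0 mo≈no with ≤-total m n
    ... | inj₁ m≤n = *-cancelʳ-when-≤ o≉0 m≤n mo≈no
    ... | inj₂ n≤m = ≈-sym (*-cancelʳ-when-≤ o≉0 n≤m (≈-sym mo≈no))

    ∃-negated-inverse : ∀ {o} → o ≉ 0 → ∃ λ u → 1 + u * o ≈ 0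
    ∃-negated-inverse {o} o≉0
      with coprime-Bézout (prime⇒coprime prime {{≢-nonZero (λ r≡0 → o≉0 (mod-≡ r≡0))}} (m%n<n o Q))
    ... | Bézout.+- x y 1+yr≡xQ = y , (begin
      1 + y * o         ≈⟨ +-congˡ 1 (*-congˡ y (≈-sym (m%Q≈m o))) ⟩
      1 + y * (o % Q)   ≡⟨ 1+yr≡xQ ⟩
      0 + x * Q         ≈⟨ m+kQ≈m 0 x ⟩
      0                 ∎)
      where open ≈-Reasoning
    ... | Bézout.-+ x y 1+xQ≡yr = q * y ,
      ≈-trans (≡⇒≈ (cong suc (*-assoc q y o))) (Equivalence.to ≈⇔+q*≈0 1≈yo)
      where
      open ≈-Reasoning
      1≈yo : 1 ≈ y * o
      1≈yo = begin
        1               ≈⟨ m+kQ≈m 1 x ⟨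
        1 + x * Q       ≡⟨ 1+xQ≡yr ⟩
        y * (o % Q)     ≈⟨ *-congˡ y (m%Q≈m o) ⟩
        y * o           ∎

  module InnerProduct (q : ℕ) where

    open Congruence q

    infix 8 _∙_
    _∙_ : ∀ {n} → Vec (Fin Q) n → Vec (Fin Q) n → ℕ
    u ∙ w = Vec.foldr _ _+_ 0 (Vec.zipWith (λ a b → toℕ a * toℕ b) u w)

    0v : ∀ {n} → Vec (Fin Q) n
    0v = Vec.replicate _ F.zero

    ¬all-zero⇒≢0v : ∀ {n} (u : Vec (Fin Q) n) → ¬ (∀ j → toℕ (Vec.lookup u j) ≡ 0) → u ≢ 0v
    ¬all-zero⇒≢0v u ¬all-zero u≡0v = ¬all-zero λ j →
      cong toℕ (trans (cong (λ w → Vec.lookup w j) u≡0v) (Vecₚ.lookup-replicate j F.zero))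

    ∙-comm : ∀ {n} (u w : Vec (Fin Q) n) → u ∙ w ≡ w ∙ u
    ∙-comm []      []      = refl
    ∙-comm (a ∷ u) (b ∷ w) = cong₂ _+_ (*-comm (toℕ a) (toℕ b)) (∙-comm u w)

    ∙-zeroˡ : ∀ {n} (w : Vec (Fin Q) n) → 0v ∙ w ≡ 0
    ∙-zeroˡ []      = refl
    ∙-zeroˡ (b ∷ w) = ∙-zeroˡ w

    ∙-zeroʳ : ∀ {n} (u : Vec (Fin Q) n) → u ∙ 0v ≡ 0
    ∙-zeroʳ u = trans (∙-comm u 0v) (∙-zeroˡ u)

    toℕ-addZ : ∀ (a b : Fin Q) → toℕ (addZ a b) ≈ toℕ a + toℕ b
    toℕ-addZ a b = ≈-trans (≡⇒≈ (toℕ-fromℕ< _)) (m%Q≈m _)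

    ∙-distribˡ-⊕ : ∀ {n} (z y c : Vec (Fin Q) n) → z ∙ (y ⊕ c) ≈ z ∙ y + z ∙ c
    ∙-distribˡ-⊕ []      []      []      = ≈-refl
    ∙-distribˡ-⊕ (a ∷ z) (b ∷ y) (d ∷ c) = begin
      toℕ a * toℕ (addZ b d) + z ∙ (y ⊕ c)
        ≈⟨ +-cong (*-congˡ (toℕ a) (toℕ-addZ b d)) (∙-distribˡ-⊕ z y c) ⟩
      toℕ a * (toℕ b + toℕ d) + (z ∙ y + z ∙ c)
        ≡⟨ cong (_+ (z ∙ y + z ∙ c)) (*-distribˡ-+ (toℕ a) (toℕ b) (toℕ d)) ⟩
      toℕ a * toℕ b + toℕ a * toℕ d + (z ∙ y + z ∙ c)
        ≡⟨ +-interchange (toℕ a * toℕ b) (toℕ a * toℕ d) (z ∙ y) (z ∙ c) ⟩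
      toℕ a * toℕ b + z ∙ y + (toℕ a * toℕ d + z ∙ c)
        ∎
      where open ≈-Reasoning

    T-⟨⟩≡ᵇ0 : ∀ {n} (u w : Vec (Fin Q) n) → T (⟨ u , w ⟩ ≡ᵇ 0) ⇔ u ∙ w ≈ 0
    T-⟨⟩≡ᵇ0 u w = T-≡ᵇ⇔≈

    ∙-⊕-cancelʳ : ∀ {n} (z u w c : Vec (Fin Q) n) → z ∙ (u ⊕ c) ≈ z ∙ (w ⊕ c) → z ∙ u ≈ z ∙ w
    ∙-⊕-cancelʳ z u w c eq = +-cancelʳ (z ∙ c)
      (≈-trans (≈-sym (∙-distribˡ-⊕ z u c)) (≈-trans eq (∙-distribˡ-⊕ z w c)))

  module Hyperplanes (q : ℕ) (prime : Prime (suc q)) where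

    open Congruence q
    open PrimeCongruence q prime
    open InnerProduct q

    root-unique : ∀ {c d} → d ≉ 0 → ∀ {s t : Fin Q} → c + toℕ s * d ≈ 0 → c + toℕ t * d ≈ 0 → s ≡ t
    root-unique {c} d≉0 {s} {t} cs≈0 ct≈0 =
      toℕ-injective (≈⇒≡ (toℕ<n s) (toℕ<n t) (*-cancelʳ d≉0 (+-cancelˡ c (≈-trans cs≈0 (≈-sym ct≈0)))))

    root-exists : ∀ {d} → d ≉ 0 → ∀ c → ∃ λ (t : Fin Q) → c + toℕ t * d ≈ 0
    root-exists {d} d≉0 c with u , 1+ud≈0 ← ∃-negated-inverse d≉0 = fromℕ< (m%n<n (c * u) Q) , (begin
      c + toℕ (fromℕ< (m%n<n (c * u) Q)) * d   ≡⟨ cong (λ t → c + t * d) (toℕ-fromℕ< (m%n<n (c * u) Q)) ⟩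
      c + c * u % Q * d                        ≈⟨ +-congˡ c (*-congʳ d (m%Q≈m (c * u))) ⟩
      c + c * u * d                            ≡⟨ c+cud≡c[1+ud] c u d ⟩
      c * (1 + u * d)                          ≈⟨ *-congˡ c 1+ud≈0 ⟩
      c * 0                                    ≡⟨ *-zeroʳ c ⟩
      0                                        ∎)
      where
      open ≈-Reasoning
      c+cud≡c[1+ud] : ∀ c u d → c + c * u * d ≡ c * (1 + u * d)
      c+cud≡c[1+ud] = solve-∀

    count-line : ∀ (a b : Fin Q) → a ≢ b → ∀ r s {P : Fin Q → Bool} →
                 (∀ t → T (P t) ⇔ r + toℕ t * toℕ a ≈ s + toℕ t * toℕ b) →
                 count P (allFin Q) ≡ 1
    count-line a b a≢b r s {P} P⇔ =
      let t₀ , root = root-exists d≉0 c in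
      count-unique Q t₀ (Equivalence.from (P⇔root t₀) root)
        (λ t Pt → root-unique d≉0 (Equivalence.to (P⇔root t) Pt) root)
      where
      -- d and c represent a - b and r - s.
      d c : ℕ
      d = toℕ a + q * toℕ b
      c = r + q * s
      d≉0 : d ≉ 0
      d≉0 d≈0 = a≢b (toℕ-injective (≈⇒≡ (toℕ<n a) (toℕ<n b) (Equivalence.from ≈⇔+q*≈0 d≈0)))
      rearrange : ∀ q r s t a b → r + t * a + q * (s + t * b) ≡ r + q * s + t * (a + q * b)
      rearrange = solve-∀
      P⇔root : ∀ t → T (P t) ⇔ c + toℕ t * d ≈ 0
      P⇔root t = begin
        T (P t)                                           ≈⟨ P⇔ t ⟩
        r + toℕ t * toℕ a ≈ s + toℕ t * toℕ b             ≈⟨ ≈⇔+q*≈0 ⟩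
        r + toℕ t * toℕ a + q * (s + toℕ t * toℕ b) ≈ 0
          ≡⟨ cong (_≈ 0) (rearrange q r s (toℕ t) (toℕ a) (toℕ b)) ⟩
        c + toℕ t * d ≈ 0                                 ∎
        where open ⇔-Reasoning

    private
      cons-⇔ : ∀ {k} r s (t a b : Fin Q) (x u w : Vec (Fin Q) k) →
               (r + (t ∷ x) ∙ (a ∷ u) ≈ s + (t ∷ x) ∙ (b ∷ w)) ⇔
               (r + toℕ t * toℕ a + x ∙ u ≈ s + toℕ t * toℕ b + x ∙ w)
      cons-⇔ r s t a b x u w rewrite +-assoc r (toℕ t * toℕ a) (x ∙ u) | +-assoc s (toℕ t * toℕ b) (x ∙ w) =
        ⇔-refl

    count-hyperplane-equal-tails : ∀ {k} (a b : Fin Q) (u : Vec (Fin Q) k) → a ≢ b →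
                                   ∀ r s {P : Vec (Fin Q) (suc k) → Bool} →
                                   (∀ x → T (P x) ⇔ r + x ∙ (a ∷ u) ≈ s + x ∙ (b ∷ u)) →
                                   count P (allVecs Q (suc k)) ≡ Q ^ k
    count-hyperplane-equal-tails {k} a b u a≢b r s {P} P⇔ = begin
      count P (allVecs Q (suc k))
        ≡⟨ ∑-allVecs-suc Q k (χ ∘ P) ⟩
      ∑[ t ∈ allFin Q ] ∑[ x ∈ allVecs Q k ] χ (P (t ∷ x))
        ≡⟨ ∑-cong (allFin Q) (λ t → ∑-cong (allVecs Q k) (λ x → χ-cong (P⇔line t x))) ⟩
      ∑[ t ∈ allFin Q ] ∑[ x ∈ allVecs Q k ] χ (line t)
        ≡⟨ ∑-cong (allFin Q) (λ t → ∑-allVecs-const Q k (χ (line t))) ⟩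
      ∑[ t ∈ allFin Q ] Q ^ k * χ (line t)
        ≡⟨ ∑-distribˡ-* (allFin Q) (χ ∘ line) (Q ^ k) ⟩
      Q ^ k * count line (allFin Q)
        ≡⟨ cong (Q ^ k *_) (count-line a b a≢b r s (λ t → T-≡ᵇ⇔≈)) ⟩
      Q ^ k * 1
        ≡⟨ *-identityʳ (Q ^ k) ⟩
      Q ^ k
        ∎
      where
      open ≡-Reasoning
      line : Fin Q → Bool
      line t = (r + toℕ t * toℕ a) % Q ≡ᵇ (s + toℕ t * toℕ b) % Q
      P⇔line : ∀ t x → T (P (t ∷ x)) ⇔ T (line t)
      P⇔line t x = ⇔-trans (P⇔ (t ∷ x)) (⇔-trans (cons-⇔ r s t a b x u u)
                     (⇔-trans (mk⇔ (+-cancelʳ (x ∙ u)) (+-congʳ (x ∙ u))) (⇔-sym T-≡ᵇ⇔≈)))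

    -- If the tails of u and w agree, the first coordinate of x is determined and the rest is free;
    -- otherwise every first coordinate leaves a hyperplane of one dimension less.
    count-hyperplane : ∀ k (u w : Vec (Fin Q) (suc k)) → u ≢ w → ∀ r s {P : Vec (Fin Q) (suc k) → Bool} →
                       (∀ x → T (P x) ⇔ r + x ∙ u ≈ s + x ∙ w) →
                       count P (allVecs Q (suc k)) ≡ Q ^ k
    count-hyperplane zero (a ∷ []) (b ∷ []) u≢w r s P⇔ =
      count-hyperplane-equal-tails a b [] (u≢w ∘ cong (_∷ [])) r s P⇔
    count-hyperplane (suc k) (a ∷ u) (b ∷ w) a∷u≢b∷w r s {P} P⇔ with Vecₚ.≡-dec Finₚ._≟_ u w
    ... | yes refl = count-hyperplane-equal-tails a b u (a∷u≢b∷w ∘ cong (_∷ u)) r s P⇔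
    ... | no u≢w = begin
      count P (allVecs Q (suc (suc k)))                          ≡⟨ ∑-allVecs-suc Q (suc k) (χ ∘ P) ⟩
      ∑[ t ∈ allFin Q ] count (P ∘ (t ∷_)) (allVecs Q (suc k))   ≡⟨ ∑-cong (allFin Q) count-slice ⟩
      ∑[ t ∈ allFin Q ] Q ^ k                                    ≡⟨ ∑-allFin-const Q (Q ^ k) ⟩
      Q ^ suc k                                                  ∎
      where
      open ≡-Reasoning
      count-slice : ∀ t → count (P ∘ (t ∷_)) (allVecs Q (suc k)) ≡ Q ^ k
      count-slice t = count-hyperplane k u w u≢w (r + toℕ t * toℕ a) (s + toℕ t * toℕ b)
        (λ x → ⇔-trans (P⇔ (t ∷ x)) (cons-⇔ r s t a b x u w))

  toℚᵘ-÷ : ∀ m d → toℚᵘ (m ÷ suc d) ≃ᵘ mkℚᵘ (ℤ.+ m) d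
  toℚᵘ-÷ m d = ℚₚ.toℚᵘ-fromℚᵘ (mkℚᵘ (ℤ.+ m) d)

  ÷≤÷ : ∀ a b c d .{{_ : NonZero b}} .{{_ : NonZero d}} → a * d ≤ c * b → a ÷ b ≤ℚ c ÷ d
  ÷≤÷ a (suc b) c (suc d) ad≤cb = ℚₚ.toℚᵘ-cancel-≤
    (ℚᵘₚ.≤-respˡ-≃ (ℚᵘₚ.≃-sym (toℚᵘ-÷ a b)) (ℚᵘₚ.≤-respʳ-≃ (ℚᵘₚ.≃-sym (toℚᵘ-÷ c d))
      (*≤* (subst₂ ℤ._≤_ (ℤₚ.pos-* a (suc d)) (ℤₚ.pos-* c (suc b)) (ℤ.+≤+ ad≤cb)))))

  ÷+÷ : ∀ a b c d .{{_ : NonZero b}} .{{_ : NonZero d}} → a ÷ b +ℚ c ÷ d ≡ (a * d + c * b) ÷ (b * d)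
  ÷+÷ a (suc b) c (suc d) = ℚₚ.toℚᵘ-injective (begin
    toℚᵘ (a ÷ suc b +ℚ c ÷ suc d)                ≈⟨ ℚₚ.toℚᵘ-homo-+ (a ÷ suc b) (c ÷ suc d) ⟩
    toℚᵘ (a ÷ suc b) +ᵘ toℚᵘ (c ÷ suc d)         ≈⟨ ℚᵘₚ.+-cong (toℚᵘ-÷ a b) (toℚᵘ-÷ c d) ⟩
    mkℚᵘ (ℤ.+ a) b +ᵘ mkℚᵘ (ℤ.+ c) d                 ≡⟨ cong (λ i → mkℚᵘ i (d + b * suc d)) numerator ⟩
    mkℚᵘ (ℤ.+ (a * suc d + c * suc b)) (d + b * suc d) ≈⟨ toℚᵘ-÷ (a * suc d + c * suc b) (d + b * suc d) ⟨
    toℚᵘ ((a * suc d + c * suc b) ÷ (suc b * suc d)) ∎)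
    where
    open ℚᵘₚ.≃-Reasoning
    numerator : ℤ.+ a ℤ.* ℤ.+ suc d ℤ.+ ℤ.+ c ℤ.* ℤ.+ suc b ≡ ℤ.+ (a * suc d + c * suc b)
    numerator = sym (trans (ℤₚ.pos-+ (a * suc d) (c * suc b))
                           (cong₂ ℤ._+_ (ℤₚ.pos-* a (suc d)) (ℤₚ.pos-* c (suc b))))

  p≤p+q : ∀ p {q} → 0ℚ ≤ℚ q → p ≤ℚ p +ℚ q
  p≤p+q p 0≤q = ℚₚ.≤-trans (ℚₚ.≤-reflexive (sym (ℚₚ.+-identityʳ p))) (ℚₚ.+-monoʳ-≤ p 0≤q)

  p≤r+q⇒p-q-s≤r : ∀ {p q r s} → p ≤ℚ r +ℚ q → 0ℚ ≤ℚ s → p -ℚ q -ℚ s ≤ℚ r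
  p≤r+q⇒p-q-s≤r {p} {q} {r} {s} p≤r+q 0≤s = begin
    p -ℚ q -ℚ s         ≤⟨ ℚₚ.+-monoʳ-≤ (p -ℚ q) (ℚₚ.neg-antimono-≤ 0≤s) ⟩
    p -ℚ q +ℚ 0ℚ        ≡⟨ ℚₚ.+-identityʳ (p -ℚ q) ⟩
    p -ℚ q              ≤⟨ ℚₚ.+-monoˡ-≤ (-ℚ q) p≤r+q ⟩
    r +ℚ q -ℚ q         ≡⟨ ℚₚ.+-assoc r q (-ℚ q) ⟩
    r +ℚ (q -ℚ q)       ≡⟨ cong (r +ℚ_) (ℚₚ.+-inverseʳ q) ⟩
    r +ℚ 0ℚ             ≡⟨ ℚₚ.+-identityʳ r ⟩
    r                   ∎
    where open ℚₚ.≤-Reasoning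

  module Bounds (q k M : ℕ) (prime : Prime (suc q))
                (v y : Fin (suc M) → Vec (Fin (suc q)) (suc k))
                (v≢0 : ∀ i → v i ≢ InnerProduct.0v q)
                (y≢y₀ : ∀ (i : Fin M) → y (F.suc i) ≢ y F.zero) where

    open Congruence q
    open InnerProduct q
    open Hyperplanes q prime

    private
      n : ℕ
      n = suc k

      V : Set
      V = Vec (Fin Q) n

    hits : V → V → Bool
    hits z c = ⟨ z , y F.zero ⊕ c ⟩ ≡ᵇ 0

    v-orthogonal : V → Fin (suc M) → Bool
    v-orthogonal z i = ⟨ z , v i ⟩ ≡ᵇ 0

    y-collides : V → Fin M → Bool
    y-collides z i = ⟨ z , y (F.suc i) ⟩ ≡ᵇ ⟨ z , y F.zero ⟩

    T-event : ∀ z c → T (event v y (z , c)) ⇔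
              (T (hits z c) × (∀ i → ¬ T (v-orthogonal z i)) × (∀ i → ¬ T (⟨ z , y (F.suc i) ⊕ c ⟩ ≡ᵇ 0)))
    T-event z c = ⇔-trans T-∧ (⇔-refl ×-⇔ ⇔-trans T-∧ (T-all-not-allFin (suc M) _ ×-⇔ T-all-not-allFin M _))

    events violations : V → ℕ
    events z     = count (λ c → event v y (z , c)) (allVecs Q n)
    violations z = count (v-orthogonal z) (allFin (suc M)) + count (y-collides z) (allFin M)

    ¬orthogonal⇒≢0v : ∀ z i → ¬ T (v-orthogonal z i) → z ≢ 0v
    ¬orthogonal⇒≢0v _ i ¬z⊥vᵢ refl = ¬z⊥vᵢ (Equivalence.from T-≡ᵇ⇔≈ (≡⇒≈ (∙-zeroˡ (v i))))

    count-hits : ∀ {z} → z ≢ 0v → count (hits z) (allVecs Q n) ≡ Q ^ k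
    count-hits {z} z≢0 = count-hyperplane k z 0v z≢0 (z ∙ y F.zero) 0 λ c → begin
      T (hits z c)                        ≈⟨ T-⟨⟩≡ᵇ0 z (y F.zero ⊕ c) ⟩
      z ∙ (y F.zero ⊕ c) ≈ 0              ≈⟨ ≈-respˡ-⇔ (∙-distribˡ-⊕ z (y F.zero) c) ⟩
      z ∙ y F.zero + z ∙ c ≈ 0
        ≡⟨ cong₂ _≈_ (cong (z ∙ y F.zero +_) (∙-comm z c)) (sym (∙-zeroʳ c)) ⟩
      z ∙ y F.zero + c ∙ z ≈ 0 + c ∙ 0v   ∎
      where open ⇔-Reasoning

    count-orthogonal : ∀ i → count (λ z → v-orthogonal z i) (allVecs Q n) ≡ Q ^ k
    count-orthogonal i = count-hyperplane k (v i) 0v (v≢0 i) 0 0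
      (λ z → ⇔-trans T-≡ᵇ⇔≈ (≡⇒⇔ (cong (z ∙ v i ≈_) (sym (∙-zeroʳ z)))))

    count-collisions : ∀ i → count (λ z → y-collides z i) (allVecs Q n) ≡ Q ^ k
    count-collisions i = count-hyperplane k (y (F.suc i)) (y F.zero) (y≢y₀ i) 0 0 (λ z → T-≡ᵇ⇔≈)

    events-≤ : ∀ z → events z ≤ Q ^ k
    events-≤ z with T? (v-orthogonal z F.zero)
    ... | yes z⊥v₀ = ≤-trans (≤-reflexive (count-none (allVecs Q n)
                       (λ c ev → proj₁ (proj₂ (Equivalence.to (T-event z c) ev)) F.zero z⊥v₀))) z≤n
    ... | no ¬z⊥v₀ = ≤-trans (count-mono (allVecs Q n) (λ c ev → proj₁ (Equivalence.to (T-event z c) ev)))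
                       (≤-reflexive (count-hits (¬orthogonal⇒≢0v z F.zero ¬z⊥v₀)))

    events-≥ : ∀ z → Q ^ k ≤ events z + violations z * Q ^ k
    events-≥ z with violations z in #violations
    ... | suc m = ≤-trans (m≤m+n (Q ^ k) (m * Q ^ k)) (m≤n+m _ (events z))
    ... | zero  = begin
      Q ^ k                          ≡⟨ count-hits (¬orthogonal⇒≢0v z F.zero (no-v F.zero)) ⟨
      count (hits z) (allVecs Q n)   ≤⟨ count-mono (allVecs Q n) hit⇒event ⟩
      events z                       ≤⟨ m≤m+n (events z) 0 ⟩
      events z + 0                   ∎
      where
      open ≤-Reasoning
      no-v : ∀ i → ¬ T (v-orthogonal z i)
      no-v = count≡0⇒¬T (suc M) (m+n≡0⇒m≡0 _ #violations)
      no-y : ∀ i → ¬ T (y-collides z i)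
      no-y = count≡0⇒¬T M (m+n≡0⇒n≡0 _ #violations)
      hit⇒event : ∀ c → T (hits z c) → T (event v y (z , c))
      hit⇒event c hit = Equivalence.from (T-event z c) (hit , no-v , λ i hitᵢ → no-y i
        (Equivalence.from T-≡ᵇ⇔≈ (∙-⊕-cancelʳ z (y (F.suc i)) (y F.zero) c
          (≈-trans (Equivalence.to (T-⟨⟩≡ᵇ0 z _) hitᵢ) (≈-sym (Equivalence.to (T-⟨⟩≡ᵇ0 z _) hit))))))

    ∑-violations : ∑[ z ∈ allVecs Q n ] violations z ≡ (suc M + M) * Q ^ k
    ∑-violations = begin
      ∑[ z ∈ allVecs Q n ] violations z
        ≡⟨ ∑-distrib-+ (allVecs Q n) _ _ ⟩
      (∑[ z ∈ allVecs Q n ] count (v-orthogonal z) (allFin (suc M))) +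
      (∑[ z ∈ allVecs Q n ] count (y-collides z) (allFin M))
        ≡⟨ cong₂ _+_ (∑-count-allFin (allVecs Q n) v-orthogonal count-orthogonal)
                     (∑-count-allFin (allVecs Q n) y-collides count-collisions) ⟩
      suc M * Q ^ k + M * Q ^ k
        ≡⟨ *-distribʳ-+ (Q ^ k) (suc M) M ⟨
      (suc M + M) * Q ^ k
        ∎
      where open ≡-Reasoning

    total : ℕ
    total = ∑[ z ∈ allVecs Q n ] events z

    total-≤ : total ≤ Q ^ n * Q ^ k
    total-≤ = ≤-trans (∑-mono-≤ (allVecs Q n) events-≤) (≤-reflexive (∑-allVecs-const Q n (Q ^ k)))

    total-≥ : Q ^ n * Q ^ k ≤ total + (suc M + M) * Q ^ k * Q ^ k
    total-≥ = begin
      Q ^ n * Q ^ k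
        ≡⟨ ∑-allVecs-const Q n (Q ^ k) ⟨
      ∑[ z ∈ allVecs Q n ] Q ^ k
        ≤⟨ ∑-mono-≤ (allVecs Q n) events-≥ ⟩
      ∑[ z ∈ allVecs Q n ] (events z + violations z * Q ^ k)
        ≡⟨ ∑-distrib-+ (allVecs Q n) events _ ⟩
      total + (∑[ z ∈ allVecs Q n ] violations z * Q ^ k)
        ≡⟨ cong (total +_) (∑-distribʳ-* (allVecs Q n) violations (Q ^ k)) ⟩
      total + (∑[ z ∈ allVecs Q n ] violations z) * Q ^ k
        ≡⟨ cong (λ m → total + m * Q ^ k) ∑-violations ⟩
      total + (suc M + M) * Q ^ k * Q ^ k
        ∎
      where open ≤-Reasoning

    prob≡total÷ : prob v y ≡ total ÷ Q ^ (n + n)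
    prob≡total÷ = cong (_÷ Q ^ (n + n)) (trans
      (length-filter≡count (event v y) (cartesianProduct (allVecs Q n) (allVecs Q n)))
      (∑-cartesianProduct (allVecs Q n) (allVecs Q n) _))

    private
      instance
        Q^n≢0 : NonZero (Q ^ n)
        Q^n≢0 = m^n≢0 Q n
        Q^2≢0 : NonZero (Q ^ 2)
        Q^2≢0 = m^n≢0 Q 2
        Q^[n+n]≢0 : NonZero (Q ^ (n + n))
        Q^[n+n]≢0 = m^n≢0 Q (n + n)
        Q^[n+n]*Q^2≢0 : NonZero (Q ^ (n + n) * Q ^ 2)
        Q^[n+n]*Q^2≢0 = m*n≢0 (Q ^ (n + n)) (Q ^ 2)

      Q^[n+n]≡ : Q ^ (n + n) ≡ Q * Q ^ k * (Q * Q ^ k)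
      Q^[n+n]≡ = ^-distribˡ-+-* Q n n

    prob-≤ : prob v y ≤ℚ 1 ÷ Q +ℚ 1 ÷ Q ^ n
    prob-≤ = begin
      prob v y          ≡⟨ prob≡total÷ ⟩
      total ÷ Q ^ (n + n) ≤⟨ ÷≤÷ total (Q ^ (n + n)) 1 Q total*Q≤ ⟩
      1 ÷ Q             ≤⟨ p≤p+q (1 ÷ Q) (÷≤÷ 0 1 1 (Q ^ n) z≤n) ⟩
      1 ÷ Q +ℚ 1 ÷ Q ^ n ∎
      where
      open ℚₚ.≤-Reasoning
      total*Q≤ : total * Q ≤ 1 * Q ^ (n + n)
      total*Q≤ = ℕ≤.begin
        total * Q                 ℕ≤.≤⟨ *-monoˡ-≤ Q total-≤ ⟩
        Q * Q ^ k * Q ^ k * Q     ℕ≤.≡⟨ rearrange Q (Q ^ k) ⟩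
        1 * (Q * Q ^ k * (Q * Q ^ k)) ℕ≤.≡⟨ cong (1 *_) Q^[n+n]≡ ⟨
        1 * Q ^ (n + n)           ℕ≤.∎
        where
        module ℕ≤ = ≤-Reasoning
        rearrange : ∀ Q P → Q * P * P * Q ≡ 1 * (Q * P * (Q * P))
        rearrange = solve-∀

    prob-≥ : 1 ÷ Q -ℚ (2 * suc M) ÷ Q ^ 2 -ℚ suc M ÷ Q ^ n ≤ℚ prob v y
    prob-≥ = p≤r+q⇒p-q-s≤r (begin
      1 ÷ Q
        ≤⟨ ÷≤÷ 1 Q _ (Q ^ (n + n) * Q ^ 2) scaled-total-≥ ⟩
      (total * Q ^ 2 + 2 * suc M * Q ^ (n + n)) ÷ (Q ^ (n + n) * Q ^ 2)
        ≡⟨ ÷+÷ total (Q ^ (n + n)) (2 * suc M) (Q ^ 2) ⟨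
      total ÷ Q ^ (n + n) +ℚ 2 * suc M ÷ Q ^ 2
        ≡⟨ cong (_+ℚ 2 * suc M ÷ Q ^ 2) prob≡total÷ ⟨
      prob v y +ℚ 2 * suc M ÷ Q ^ 2
        ∎)
      (÷≤÷ 0 1 (suc M) (Q ^ n) z≤n)
      where
      open ℚₚ.≤-Reasoning
      scaled-total-≥ : 1 * (Q ^ (n + n) * Q ^ 2) ≤ (total * Q ^ 2 + 2 * suc M * Q ^ (n + n)) * Q
      scaled-total-≥ rewrite Q^[n+n]≡ = ℕ≤.begin
        1 * (Q * P * (Q * P) * Q ^ 2)                          ℕ≤.≡⟨ lhs Q P ⟩
        Q * Q * Q * (Q * P * P)                                ℕ≤.≤⟨ *-monoʳ-≤ (Q * Q * Q) total-≥ ⟩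
        Q * Q * Q * (total + (suc M + M) * P * P)              ℕ≤.≤⟨ *-monoʳ-≤ (Q * Q * Q) (+-monoʳ-≤ total
                                                                     (*-monoˡ-≤ P (*-monoˡ-≤ P N+M≤2N))) ⟩
        Q * Q * Q * (total + 2 * suc M * P * P)                ℕ≤.≡⟨ rhs Q P total (2 * suc M) ⟩
        (total * Q ^ 2 + 2 * suc M * (Q * P * (Q * P))) * Q    ℕ≤.∎
        where
        module ℕ≤ = ≤-Reasoning
        P = Q ^ k
        N+M≤2N : suc M + M ≤ 2 * suc M
        N+M≤2N = +-monoʳ-≤ (suc M) (≤-trans (n≤1+n M) (m≤m+n (suc M) 0))
        lhs : ∀ Q P → 1 * (Q * P * (Q * P) * (Q * (Q * 1))) ≡ Q * Q * Q * (Q * P * P)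
        lhs = solve-∀
        rhs : ∀ Q P E N → Q * Q * Q * (E + N * P * P) ≡ (E * (Q * (Q * 1)) + N * (Q * P * (Q * P))) * Q
        rhs = solve-∀

open import Data.Nat using (ℕ; zero; suc; _^_; _*_)
open import Data.Nat.Primality using (Prime; ¬prime[0])
open import Data.Fin using (Fin; toℕ)
import Data.Fin as F
open import Data.Vec using (Vec; lookup)
open import Data.Rational using (_≤_; _+_; _-_)
open import Relation.Binary.PropositionalEquality using (_≡_; _≢_)
open import Relation.Nullary using (¬_)
open import Data.Empty using (⊥-elim)
import Data.Product
open import Data.Product using (_,_)
open EventCounting using (module InnerProduct; module Bounds)

lemmaA1 : (Q n M : ℕ) → Prime Q
        → (v y : Fin (suc M) → Vec (Fin Q) n)
        → (∀ i → ¬ (∀ j → toℕ (lookup (v i) j) ≡ 0))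
        → (∀ (i : Fin M) → y (F.suc i) ≢ y F.zero)
        → ((1 ÷ Q) - ((2 * suc M) ÷ (Q ^ 2)) - (suc M ÷ (Q ^ n)) ≤ prob v y)
          Data.Product.× (prob v y ≤ (1 ÷ Q) + (1 ÷ (Q ^ n)))
lemmaA1 zero    _       _ isPrime _ _ _   _    = ⊥-elim (¬prime[0] isPrime)
lemmaA1 (suc q) zero    _ _       _ _ v≢0 _    = ⊥-elim (v≢0 F.zero (λ ()))
lemmaA1 (suc q) (suc k) M isPrime v y v≢0 y≢y₀ = prob-≥ , prob-≤
  where
  v≢0v : ∀ i → v i ≢ InnerProduct.0v q
  v≢0v i = InnerProduct.¬all-zero⇒≢0v q (v i) (v≢0 i)
  open Bounds q k M isPrime v y v≢0v y≢y₀
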